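{- Let $p$ be an odd prime and $L$ a $\mathbb{Z}_p$-lattice in a $\mathbb{Q}_p$-vector space $V$ with symmetric bilinear form $B$. An element $\bm x\in L$ is simple of index $r\in\mathbb{N}_0$ if and only if there exists $\bm w\in L$ such that $v(L;\bm x)=v(\tfrac12B(\bm x,\bm w))=v(L;\bm w)=r$.
   Context: $v$ is the $p$-adic valuation. For $\bm x\in V$, $v(L;\bm x)=\min_{\bm y\in L}v(\tfrac12B(\bm x,\bm y))$. For $r\in\mathbb{N}_0$, $L^{(r)}=\{\bm x\in L: v(L;\bm x)\ge r\}$ and $v(L^{(r)};\bm x)=\min_{\bm y\in L^{(r)}}v(\tfrac12B(\bm x,\bm y))$. An element $\bm x\in L$ is simple of index $r$ if $v(L;\bm x)=v(L^{(r)};\bm x)=r$. -}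

module Defs where

open import Data.Nat using (ℕ; zero; suc; _^_) renaming (_+_ to _+ℕ_)
open import Data.Nat.DivMod using (_/_)
open import Data.Integer using (ℤ; +_; _+_; _-_; _*_)
open import Data.Integer.Divisibility using (_∣_)
open import Data.Fin using (Fin; zero; suc)
open import Data.Product using (Σ; _×_; ∃)
open import Relation.Nullary using (¬_)

Σᶠ : (n : ℕ) → (Fin n → ℤ) → ℤ
Σᶠ zero    f = + 0
Σᶠ (suc n) f = f zero + Σᶠ n (λ i → f (suc i))

module Padic (p : ℕ) where

  -- ℤ_p as compatible sequences: seq n is a representative of the residue mod p^n
  record Zp : Set where
    field
      seq    : ℕ → ℤ
      compat : ∀ n → (+ (p ^ n)) ∣ (seq (suc n) - seq n)
  open Zp public

  _≈_ : Zp → Zp → Set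
  a ≈ b = ∀ n → (+ (p ^ n)) ∣ (seq a n - seq b n)

  -- representative of 1/2 ∈ ℤ_p modulo p^n (valid since p is odd): (p^n+1)/2
  half : ℕ → ℤ
  half n = + ((p ^ n +ℕ 1) / 2)

  -- A ℤ_p-lattice L of rank n with basis e_1..e_n; L ≅ Fin n → ℤ_p.
  -- The symmetric bilinear form B restricted to L has Gram matrix p^(-k) · H,
  -- with H a symmetric n×n matrix over ℤ_p.
  module Lattice (n k : ℕ) (H : Fin n → Fin n → Zp) where

    L : Set
    L = Fin n → Zp

    Hraw : L → L → ℕ → ℤ
    Hraw x y m = Σᶠ n (λ i → Σᶠ n (λ j → seq (x i) m * seq (H i j) m * seq (y j) m))

    halfH : L → L → ℕ → ℤ
    halfH x y m = half m * Hraw x y m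

    -- v(½ B(x,y)) ≥ r,  i.e.  p^(r+k) ∣ ½ H(x,y) in ℤ_p
    vHalfB≥ : L → L → ℕ → Set
    vHalfB≥ x y r = (+ (p ^ (r +ℕ k))) ∣ halfH x y (r +ℕ k)

    vHalfB≡ : L → L → ℕ → Set
    vHalfB≡ x y r = vHalfB≥ x y r × ¬ vHalfB≥ x y (suc r)

    vL≥ : L → ℕ → Set
    vL≥ x r = ∀ y → vHalfB≥ x y r

    vL≡ : L → ℕ → Set
    vL≡ x r = vL≥ x r × ∃ λ y → vHalfB≡ x y r

    InL^ : ℕ → L → Set
    InL^ r x = vL≥ x r

    vL^≡ : ℕ → L → ℕ → Set
    vL^≡ r x s = (∀ y → InL^ r y → vHalfB≥ x y s)
               × ∃ λ y → InL^ r y × vHalfB≡ x y s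

    Simple : L → ℕ → Set
    Simple x r = vL≡ x r × vL^≡ r x r

-- Conversely, w ∈ L^(r) with
-- v(½B(x,w)) = r bounds v(L^(r); x) by r from above, and L^(r) ⊆ L bounds it from below.
module Submission where

open import Defs
open import Data.Nat using (ℕ; zero; suc; _^_) renaming (_+_ to _+ℕ_)
open import Data.Nat.Primality using (Prime)
open import Data.Fin using (Fin; zero; suc)
open import Data.Integer using (ℤ; +_; _+_; _-_; _*_)
open import Data.Integer.Divisibility.Signed
  using (_∣_; divides; ∣ᵤ⇒∣; ∣⇒∣ᵤ; ∣m∣n⇒∣m+n; ∣m∣n⇒∣m-n; ∣n⇒∣m*n)
open import Data.Integer.Tactic.RingSolver using (solve-∀)
open import Data.Product using (_×_; ∃; _,_; proj₁)
open import Function.Bundles using (_⇔_; mk⇔)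
open import Relation.Binary.PropositionalEquality using (_≡_; _≢_; refl; cong; sym; trans; subst)

Σᶠ-0 : ∀ m → Σᶠ m (λ _ → + 0) ≡ + 0
Σᶠ-0 zero    = refl
Σᶠ-0 (suc m) = cong (_+_ (+ 0)) (Σᶠ-0 m)

Σᶠ-distrib-+ : ∀ m (f g : Fin m → ℤ) → Σᶠ m f + Σᶠ m g ≡ Σᶠ m (λ j → f j + g j)
Σᶠ-distrib-+ zero    f g = refl
Σᶠ-distrib-+ (suc m) f g =
  trans (interchange (f zero) (g zero) (Σᶠ m (f ∘suc)) (Σᶠ m (g ∘suc)))
        (cong (_+_ (f zero + g zero)) (Σᶠ-distrib-+ m (f ∘suc) (g ∘suc)))
  where
    _∘suc : (Fin (suc m) → ℤ) → Fin m → ℤ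
    h ∘suc = λ j → h (suc j)
    interchange : ∀ a b A B → (a + A) + (b + B) ≡ (a + b) + (A + B)
    interchange = solve-∀

Σᶠ-comm : ∀ m l (f : Fin m → Fin l → ℤ) →
  Σᶠ m (λ i → Σᶠ l (f i)) ≡ Σᶠ l (λ j → Σᶠ m (λ i → f i j))
Σᶠ-comm zero    l f = sym (Σᶠ-0 l)
Σᶠ-comm (suc m) l f =
  trans (cong (_+_ (Σᶠ l (f zero))) (Σᶠ-comm m l (λ i → f (suc i))))
        (Σᶠ-distrib-+ l (f zero) (λ j → Σᶠ m (λ i → f (suc i) j)))

Σᶠ-cong-∣ : ∀ {d} m (f g : Fin m → ℤ) →
  (∀ i → d ∣ f i - g i) → d ∣ Σᶠ m f - Σᶠ m g
Σᶠ-cong-∣     zero    f g f≡g = divides (+ 0) refl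
Σᶠ-cong-∣ {d} (suc m) f g f≡g =
  subst (d ∣_) (regroup (f zero) (g zero) (Σᶠ m (λ i → f (suc i))) (Σᶠ m (λ i → g (suc i))))
        (∣m∣n⇒∣m+n (f≡g zero) (Σᶠ-cong-∣ m (λ i → f (suc i)) (λ i → g (suc i)) (λ i → f≡g (suc i))))
  where
    regroup : ∀ a b A B → (a - b) + (A - B) ≡ (a + A) - (b + B)
    regroup = solve-∀

module _ (p n k : ℕ) (H : Fin n → Fin n → Padic.Zp p)
         (H-sym : ∀ i j → Padic._≈_ p (H i j) (H j i)) where
  open Padic p
  open Lattice n k H

  Hraw-sym : ∀ x y m → + (p ^ m) ∣ Hraw x y m - Hraw y x m
  Hraw-sym x y m =
    subst (λ h → + (p ^ m) ∣ Hraw x y m - h)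
          (sym (Σᶠ-comm n n (λ i j → seq (y i) m * seq (H i j) m * seq (x j) m)))
          (Σᶠ-cong-∣ n _ _ λ i → Σᶠ-cong-∣ n _ _ λ j →
            subst (+ (p ^ m) ∣_) (factor (seq (x i) m) (seq (y j) m) (seq (H i j) m) (seq (H j i) m))
                  (∣n⇒∣m*n (seq (x i) m * seq (y j) m) (∣ᵤ⇒∣ (H-sym i j m))))
    where
      factor : ∀ a b h h′ → (a * b) * (h - h′) ≡ a * h * b - b * h′ * a
      factor = solve-∀

  vHalfB≥-sym : ∀ x y s → vHalfB≥ x y s → vHalfB≥ y x s
  vHalfB≥-sym x y s xy≥s =
    ∣⇒∣ᵤ (subst (+ (p ^ m) ∣_) (cancel (half m) (Hraw x y m) (Hraw y x m))
                (∣m∣n⇒∣m-n (∣ᵤ⇒∣ {i = half m * Hraw x y m} xy≥s) (∣n⇒∣m*n (half m) (Hraw-sym x y m))))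
    where
      m = s +ℕ k
      cancel : ∀ c a b → c * a - c * (a - b) ≡ c * b
      cancel = solve-∀

  vHalfB≡-sym : ∀ x y s → vHalfB≡ x y s → vHalfB≡ y x s
  vHalfB≡-sym x y s (xy≥s , xy≱s+1) =
    vHalfB≥-sym x y s xy≥s , λ yx≥s+1 → xy≱s+1 (vHalfB≥-sym y x (suc s) yx≥s+1)

proposition4p2 : (p : ℕ) → Prime p → p ≢ 2 →
    (n k : ℕ) (H : Fin n → Fin n → Padic.Zp p) →
    (∀ i j → Padic._≈_ p (H i j) (H j i)) →
    (x : Padic.Lattice.L p n k H) (r : ℕ) →
    Padic.Lattice.Simple p n k H x r
      ⇔ (∃ λ w → Padic.Lattice.vL≡ p n k H x r
                × Padic.Lattice.vHalfB≡ p n k H x w r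
                × Padic.Lattice.vL≡ p n k H w r)
proposition4p2 p _ _ n k H H-sym x r = mk⇔ simple⇒witness witness⇒simple
  where
    open Padic p
    open Lattice n k H

    simple⇒witness : Simple x r → ∃ λ w → vL≡ x r × vHalfB≡ x w r × vL≡ w r
    simple⇒witness (vx≡r , _ , y , y∈L^r , xy≡r) =
      y , vx≡r , xy≡r , y∈L^r , x , vHalfB≡-sym p n k H H-sym x y r xy≡r

    witness⇒simple : (∃ λ w → vL≡ x r × vHalfB≡ x w r × vL≡ w r) → Simple x r
    witness⇒simple (w , vx≡r , xw≡r , w∈L^r , _) =
      vx≡r , (λ y _ → proj₁ vx≡r y) , w , w∈L^r , xw≡r
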